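{- For every positive integer $n\notin\{1,2,4,6\}$ there exists a connected stepwise irregular graph of order $n$.
   Context: All graphs are finite and simple. A graph $G$ is stepwise irregular (SI) if for every edge $uv\in E(G)$ one has $|d_G(u)-d_G(v)|=1$, where $d_G$ denotes degree. The order of a graph is its number of vertices. -}

module Defs where

open import Data.Nat using (ℕ; suc; _+_)
open import Data.Bool using (Bool; true; false)
open import Data.Fin using (Fin)
open import Data.List using (List; []; _∷_; filter; length; allFin)
open import Data.Product using (_×_; Σ; _,_)
open import Data.Sum using (_⊎_)
open import Relation.Binary.PropositionalEquality using (_≡_)
open import Relation.Nullary using (¬_)
open import Data.Bool.Properties using () renaming (_≟_ to _≟ᵇ_)

record Graph (n : ℕ) : Set where
  field
    adj   : Fin n → Fin n → Bool
    sym   : ∀ u v → adj u v ≡ adj v u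
    irrefl : ∀ u → adj u u ≡ false

open Graph public

Adj : ∀ {n} → Graph n → Fin n → Fin n → Set
Adj G u v = adj G u v ≡ true

degree : ∀ {n} → Graph n → Fin n → ℕ
degree {n} G v = length (filter (λ u → adj G v u ≟ᵇ true) (allFin n))

data Walk {n : ℕ} (G : Graph n) : Fin n → Fin n → Set where
  here : ∀ u → Walk G u u
  step : ∀ {u w v} → Adj G u w → Walk G w v → Walk G u v

Connected : ∀ {n} → Graph n → Set
Connected {n} G = ∀ (u v : Fin n) → Walk G u v

StepwiseIrregular : ∀ {n} → Graph n → Set
StepwiseIrregular {n} G =
  ∀ (u v : Fin n) → Adj G u v →
    (degree G u ≡ suc (degree G v)) ⊎ (degree G v ≡ suc (degree G u))

module Submission where

-- The graphs are glued from small pieces.  A *rooted* piece is a connected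
-- graph with a root r that becomes SI once r receives exactly one more
-- neighbour; its *root target* is the final degree deg(r) + 1.  Joining two
-- disjoint graphs by a single edge adds one to the degrees of its endpoints
-- and keeps the union connected (module Join).
-- Hence two rooted pieces whose root targets differ by one close up into a
-- connected SI graph, and a rooted piece with root target 2 can be grown by
-- four vertices by attaching the path  p – a – b – c  at a, with p as new root.
--
-- Growing the rooted path on two vertices j times gives rooted chains of
-- order 2 + 4j.  Closing them with four concrete rooted pieces of orders
-- 1, 6, 7 and 12 (root targets 1, 3, 3, 3) realises every order
-- 3 + 4j, 8 + 4j, 9 + 4j and 14 + 4j; the remaining orders 5 and 10 are
-- realised by K(2,3) and the subdivided K4.

open import Defs
open import Data.Nat using (ℕ; zero; suc; _+_)
open import Data.Nat.Properties using (+-assoc; +-comm; +-identityʳ) renaming (_≟_ to _≟ℕ_)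
open import Data.Bool using (Bool; true; false; _∧_; _∨_; T; if_then_else_)
open import Data.Bool.Properties using (∧-comm; ∨-comm) renaming (_≟_ to _≟ᵇ_)
open import Data.Fin using (Fin; zero; suc; splitAt; _↑ˡ_; _↑ʳ_; #_)
open import Data.Fin.Properties using (_≟_; all?; splitAt-↑ˡ; splitAt-↑ʳ; splitAt⁻¹-↑ˡ; splitAt⁻¹-↑ʳ)
open import Data.List using (List; []; _∷_; filter; length; tabulate)
open import Data.Bool.ListAction using (any)
open import Data.Vec using (Vec; []; _∷_; lookup)
open import Data.Product using (Σ; _×_; _,_)
open import Data.Sum using (_⊎_; inj₁; inj₂; [_,_]′; map₁; swap)
open import Data.Empty using (⊥-elim)
open import Function using (_∘_)
open import Relation.Binary.PropositionalEquality
  using (_≡_; _≗_; refl; trans; cong; cong₂; subst; subst₂)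
  renaming (sym to ≡-sym)
open import Relation.Nullary using (¬_; Dec; yes; no; does)
open import Relation.Nullary.Decidable using (True; toWitness; from-yes; dec-true; _⊎-dec_; _→-dec_; T?)

-- Since
-- StepwiseIrregular G unfolds to  StepwiseFor G (degree G), the lemmas below
-- can work with "virtual" degrees that only later coincide with real ones.

Step : ℕ → ℕ → Set
Step a b = a ≡ suc b ⊎ b ≡ suc a

step? : ∀ a b → Dec (Step a b)
step? a b = (a ≟ℕ suc b) ⊎-dec (b ≟ℕ suc a)

StepwiseFor : ∀ {n} → Graph n → (Fin n → ℕ) → Set
StepwiseFor {n} G D = ∀ (u v : Fin n) → Adj G u v → Step (D u) (D v)

stepwise-resp : ∀ {n} (G : Graph n) {D E : Fin n → ℕ} → D ≗ E →
  StepwiseFor G D → StepwiseFor G E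
stepwise-resp G D≗E si u v uv = subst₂ Step (D≗E u) (D≗E v) (si u v uv)

ConnectedSI : ℕ → Set
ConnectedSI n = Σ (Graph n) (λ G → Connected G × StepwiseIrregular G)

bit : Bool → ℕ
bit b = if b then 1 else 0

count : ∀ {n} → (Fin n → Bool) → ℕ
count {zero}  f = 0
count {suc n} f = bit (f zero) + count (f ∘ suc)

count-false : ∀ n → count {n} (λ _ → false) ≡ 0
count-false zero    = refl
count-false (suc n) = count-false n

count-point : ∀ {n} (t : Fin n) → count (λ w → does (w ≟ t)) ≡ 1
count-point {suc n} zero    = cong suc (count-false n)
count-point {suc n} (suc t) = count-point t

count-splitAt : ∀ k {m} (g : Fin k ⊎ Fin m → Bool) →
  count (g ∘ splitAt k) ≡ count (g ∘ inj₁) + count (g ∘ inj₂)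
count-splitAt zero    g = refl
count-splitAt (suc k) g =
  trans (cong (bit (g (inj₁ zero)) +_) (count-splitAt k (g ∘ map₁ suc)))
        (≡-sym (+-assoc (bit (g (inj₁ zero))) _ _))

filter-tabulate : ∀ {A : Set} {n} (f : A → Bool) (g : Fin n → A) →
  length (filter (λ a → f a ≟ᵇ true) (tabulate g)) ≡ count (f ∘ g)
filter-tabulate {n = zero}  f g = refl
filter-tabulate {n = suc n} f g with f (g zero)
... | true  = cong suc (filter-tabulate f (g ∘ suc))
... | false = filter-tabulate f (g ∘ suc)

degree-count : ∀ {n} (G : Graph n) (u : Fin n) → degree G u ≡ count (adj G u)
degree-count G u = filter-tabulate (adj G u) (λ v → v)

module _ {n : ℕ} {G : Graph n} where

  _++ʷ_ : ∀ {u v w} → Walk G u v → Walk G v w → Walk G u w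
  here _    ++ʷ q = q
  step uw p ++ʷ q = step uw (p ++ʷ q)

  reverseʷ : ∀ {u v} → Walk G u v → Walk G v u
  reverseʷ (here u)             = here u
  reverseʷ (step {u} {w} uw p) = reverseʷ p ++ʷ step (trans (sym G w u) uw) (here u)

  connected-via : (h : Fin n) → (∀ u → Walk G u h) → Connected G
  connected-via h toHub u v = toHub u ++ʷ reverseʷ (toHub v)

mapʷ : ∀ {n n'} {G : Graph n} {G' : Graph n'} (f : Fin n → Fin n') →
  (∀ u v → Adj G u v → Adj G' (f u) (f v)) →
  ∀ {u v} → Walk G u v → Walk G' (f u) (f v)
mapʷ f hom (here u)             = here (f u)
mapʷ f hom (step {u} {w} uw p) = step (hom u w uw) (mapʷ f hom p)

-- The degree assignment D raised by one at the vertex r: the degrees a graph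
-- will have after r has received one more neighbour.
raise : ∀ {n} → Fin n → (Fin n → ℕ) → Fin n → ℕ
raise r D x = D x + bit (does (x ≟ r))

count-guarded-point : ∀ {n} (b : Bool) (t : Fin n) → count (λ w → b ∧ does (w ≟ t)) ≡ bit b
count-guarded-point {n} false t = count-false n
count-guarded-point      true  t = count-point t

module Join {k m : ℕ} (H : Graph k) (a : Fin k) (G : Graph m) (t : Fin m) where

  link : Fin k ⊎ Fin m → Fin k ⊎ Fin m → Bool
  link (inj₁ i) (inj₁ j) = adj H i j
  link (inj₁ i) (inj₂ w) = does (i ≟ a) ∧ does (w ≟ t)
  link (inj₂ w) (inj₁ i) = does (w ≟ t) ∧ does (i ≟ a)
  link (inj₂ v) (inj₂ w) = adj G v w

  link-sym : ∀ p q → link p q ≡ link q p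
  link-sym (inj₁ i) (inj₁ j) = sym H i j
  link-sym (inj₁ i) (inj₂ w) = ∧-comm (does (i ≟ a)) (does (w ≟ t))
  link-sym (inj₂ w) (inj₁ i) = ∧-comm (does (w ≟ t)) (does (i ≟ a))
  link-sym (inj₂ v) (inj₂ w) = sym G v w

  link-irrefl : ∀ p → link p p ≡ false
  link-irrefl (inj₁ i) = irrefl H i
  link-irrefl (inj₂ w) = irrefl G w

  graph : Graph (k + m)
  graph = record
    { adj    = λ x y → link (splitAt k x) (splitAt k y)
    ; sym    = λ x y → link-sym (splitAt k x) (splitAt k y)
    ; irrefl = λ x → link-irrefl (splitAt k x) }

  degree-join : ∀ x →
    degree graph x ≡ [ raise a (degree H) , raise t (degree G) ]′ (splitAt k x)
  degree-join x =
    trans (degree-count graph x)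
          (trans (count-splitAt k (link (splitAt k x))) (row (splitAt k x)))
    where
    row : ∀ p → count (link p ∘ inj₁) + count (link p ∘ inj₂) ≡
                [ raise a (degree H) , raise t (degree G) ]′ p
    row (inj₁ i) = cong₂ _+_ (≡-sym (degree-count H i)) (count-guarded-point (does (i ≟ a)) t)
    row (inj₂ w) =
      trans (+-comm (count (link (inj₂ w) ∘ inj₁)) _)
            (cong₂ _+_ (≡-sym (degree-count G w)) (count-guarded-point (does (w ≟ t)) a))

  stepwise-join : ∀ {DH DG} → StepwiseFor H DH → StepwiseFor G DG → Step (DH a) (DG t) →
    StepwiseFor graph (λ x → [ DH , DG ]′ (splitAt k x))
  stepwise-join {DH} {DG} siH siG bridgeStep x y = link-step (splitAt k x) (splitAt k y)
    where
    link-step : ∀ p q → link p q ≡ true → Step ([ DH , DG ]′ p) ([ DH , DG ]′ q)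
    link-step (inj₁ i) (inj₁ j) e = siH i j e
    link-step (inj₂ v) (inj₂ w) e = siG v w e
    link-step (inj₁ i) (inj₂ w) e with i ≟ a | w ≟ t
    ... | yes refl | yes refl = bridgeStep
    link-step (inj₂ w) (inj₁ i) e with w ≟ t | i ≟ a
    ... | yes refl | yes refl = swap bridgeStep

  adjˡ : ∀ i j → Adj H i j → Adj graph (i ↑ˡ m) (j ↑ˡ m)
  adjˡ i j e rewrite splitAt-↑ˡ k i m | splitAt-↑ˡ k j m = e

  adjʳ : ∀ v w → Adj G v w → Adj graph (k ↑ʳ v) (k ↑ʳ w)
  adjʳ v w e rewrite splitAt-↑ʳ k m v | splitAt-↑ʳ k m w = e

  bridge : Adj graph (k ↑ʳ t) (a ↑ˡ m)
  bridge rewrite splitAt-↑ʳ k m t | splitAt-↑ˡ k a m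
               | dec-true (t ≟ t) refl | dec-true (a ≟ a) refl = refl

  connected-join : Connected H → Connected G → Connected graph
  connected-join cH cG = connected-via (a ↑ˡ m) toHub
    where
    toHub : ∀ x → Walk graph x (a ↑ˡ m)
    toHub x with splitAt k x in eq
    ... | inj₁ i = subst (λ y → Walk graph y (a ↑ˡ m)) (splitAt⁻¹-↑ˡ eq)
                         (mapʷ (_↑ˡ m) adjˡ (cH i a))
    ... | inj₂ w = subst (λ y → Walk graph y (a ↑ˡ m)) (splitAt⁻¹-↑ʳ eq)
                         (mapʷ (k ↑ʳ_) adjʳ (cG w t) ++ʷ step bridge (here _))

record Rooted (d n : ℕ) : Set where
  field
    graph      : Graph n
    root       : Fin n
    connected  : Connected graph
    stepwise   : StepwiseFor graph (raise root (degree graph))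
    rootTarget : raise root (degree graph) root ≡ d

close : ∀ {d e k m} → Rooted d k → Rooted e m → Step d e → ConnectedSI (k + m)
close {k = k} P Q d∼e =
  J.graph ,
  J.connected-join P.connected Q.connected ,
  stepwise-resp J.graph (λ x → ≡-sym (J.degree-join x))
    (J.stepwise-join P.stepwise Q.stepwise
       (subst₂ Step (≡-sym P.rootTarget) (≡-sym Q.rootTarget) d∼e))
  where
  module P = Rooted P
  module Q = Rooted Q
  module J = Join P.graph P.root Q.graph Q.root

joins : ∀ {n} → Fin n → Fin n → Fin n × Fin n → Bool
joins u v (a , b) = (does (a ≟ u) ∧ does (b ≟ v)) ∨ (does (a ≟ v) ∧ does (b ≟ u))

fromEdges : ∀ {n} → List (Fin n × Fin n) → Fin n → Fin n → Bool
fromEdges es u v = any (joins u v) es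

fromEdges-sym : ∀ {n} (es : List (Fin n × Fin n)) u v → fromEdges es u v ≡ fromEdges es v u
fromEdges-sym []             u v = refl
fromEdges-sym ((a , b) ∷ es) u v =
  cong₂ _∨_ (∨-comm (does (a ≟ u) ∧ does (b ≟ v)) _) (fromEdges-sym es u v)

loopless? : ∀ {n} (es : List (Fin n × Fin n)) → Dec (∀ u → fromEdges es u u ≡ false)
loopless? es = all? (λ u → fromEdges es u u ≟ᵇ false)

edgeGraph : ∀ {n} (es : List (Fin n × Fin n)) → {True (loopless? es)} → Graph n
edgeGraph es {noLoop} = record
  { adj = fromEdges es ; sym = fromEdges-sym es ; irrefl = toWitness noLoop }

stepwise? : ∀ {n} (G : Graph n) (D : Fin n → ℕ) → Dec (StepwiseFor G D)
stepwise? G D = all? λ u → all? λ v → (adj G u v ≟ᵇ true) →-dec step? (D u) (D v)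

-- Connectivity is certified by a parent map: following parents from any
-- vertex along edges reaches the root within n steps.
module _ {n : ℕ} (G : Graph n) (r : Fin n) (parent : Fin n → Fin n) where

  reachesRoot : ℕ → Fin n → Bool
  reachesRoot zero    u = does (u ≟ r)
  reachesRoot (suc f) u = does (u ≟ r) ∨ (adj G u (parent u) ∧ reachesRoot f (parent u))

  walkToRoot : ∀ f u → T (reachesRoot f u) → Walk G u r
  walkToRoot zero    u ok with u ≟ r
  ... | yes refl = here u
  walkToRoot (suc f) u ok with u ≟ r
  ... | yes refl = here u
  ... | no _ with adj G u (parent u) in uw
  ...   | true = step uw (walkToRoot f (parent u) ok)

connected-by : ∀ {n} (G : Graph n) (r : Fin n) (parent : Vec (Fin n) n) →
  {True (all? (λ u → T? (reachesRoot G r (lookup parent) n u)))} → Connected G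
connected-by {n} G r parent {ok} =
  connected-via r (λ u → walkToRoot G r (lookup parent) n u (toWitness ok u))

rootedByEvaluation : ∀ {n} (G : Graph n) (r : Fin n) (parent : Vec (Fin n) n) →
  {True (all? (λ u → T? (reachesRoot G r (lookup parent) n u)))} →
  {True (stepwise? G (raise r (degree G)))} → Rooted (raise r (degree G) r) n
rootedByEvaluation G r parent {conn} {si} = record
  { graph = G ; root = r ; connected = connected-by G r parent {conn}
  ; stepwise = toWitness si ; rootTarget = refl }

closedByEvaluation : ∀ {n} (G : Graph n) (r : Fin n) (parent : Vec (Fin n) n) →
  {True (all? (λ u → T? (reachesRoot G r (lookup parent) n u)))} →
  {True (stepwise? G (degree G))} → ConnectedSI n
closedByEvaluation G r parent {conn} {si} = G , connected-by G r parent {conn} , toWitness si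

-- The path  p – a – b – c  (vertices 0, 1, 2, 3) used for growing.  With p
-- and a raised, its degrees become 2, 3, 2, 1, which is SI.
growthPath : Graph 4
growthPath = edgeGraph ((# 0 , # 1) ∷ (# 1 , # 2) ∷ (# 2 , # 3) ∷ [])

growthTarget : Fin 4 → ℕ
growthTarget = raise (# 0) (raise (# 1) (degree growthPath))

growthPath-stepwise : StepwiseFor growthPath growthTarget
growthPath-stepwise = from-yes (stepwise? growthPath growthTarget)

growthPath-connected : Connected growthPath
growthPath-connected = connected-by growthPath (# 0) (# 0 ∷ # 0 ∷ # 1 ∷ # 2 ∷ [])

-- Growing: attach a to the root (target 2, so the final degree 3 of a is a
-- step away); the new root is p, again with target 2.
grow : ∀ {m} → Rooted 2 m → Rooted 2 (4 + m)
grow {m} R = record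
  { graph      = J.graph
  ; root       = zero
  ; connected  = J.connected-join growthPath-connected R.connected
  ; stepwise   = stepwise-resp J.graph (≡-sym ∘ target)
                   (J.stepwise-join growthPath-stepwise R.stepwise
                      (subst (Step 3) (≡-sym R.rootTarget) (inj₁ refl)))
  ; rootTarget = target zero }
  where
  module R = Rooted R
  module J = Join growthPath (# 1) R.graph R.root
  Old : Fin m → ℕ
  Old = raise R.root (degree R.graph)

  raise-port : ∀ x →
    [ raise (# 1) (degree growthPath) , Old ]′ (splitAt 4 x) + bit (does (x ≟ zero))
      ≡ [ growthTarget , Old ]′ (splitAt 4 x)
  raise-port zero                      = refl
  raise-port (suc zero)                = refl
  raise-port (suc (suc zero))          = refl
  raise-port (suc (suc (suc zero)))    = refl
  raise-port (suc (suc (suc (suc w)))) = +-identityʳ (Old w)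

  target : ∀ x → raise zero (degree J.graph) x ≡ [ growthTarget , Old ]′ (splitAt 4 x)
  target x = trans (cong (_+ bit (does (x ≟ zero))) (J.degree-join x)) (raise-port x)

rootedEdge : Rooted 2 2
rootedEdge = rootedByEvaluation (edgeGraph ((# 0 , # 1) ∷ [])) (# 0) (# 0 ∷ # 0 ∷ [])

chainOrder : ℕ → ℕ
chainOrder zero    = 2
chainOrder (suc j) = 4 + chainOrder j

chain : ∀ j → Rooted 2 (chainOrder j)
chain zero    = rootedEdge
chain (suc j) = grow (chain j)

-- Closing pieces, rooted at vertex 0: a single vertex (target 1); the 4-cycle
-- r – x – b – y with the path b – z – l attached (target 3); the theta graph
-- joining c and b by paths of lengths 2, 2 and 4, rooted at the middle r of the
-- long one (target 3); and K4 with one edge uv replaced by a new vertex r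
-- adjacent to u and v, every edge then subdivided (target 3).
singleVertex : Rooted 1 1
singleVertex = rootedByEvaluation (edgeGraph []) (# 0) (# 0 ∷ [])

squareWithTail : Rooted 3 6
squareWithTail = rootedByEvaluation
  (edgeGraph ((# 0 , # 1) ∷ (# 0 , # 2) ∷ (# 1 , # 3) ∷ (# 2 , # 3) ∷ (# 3 , # 4) ∷
              (# 4 , # 5) ∷ []))
  (# 0) (# 0 ∷ # 0 ∷ # 0 ∷ # 1 ∷ # 3 ∷ # 4 ∷ [])

theta : Rooted 3 7
theta = rootedByEvaluation
  (edgeGraph ((# 0 , # 1) ∷ (# 1 , # 3) ∷ (# 0 , # 2) ∷ (# 2 , # 4) ∷ (# 3 , # 5) ∷
              (# 3 , # 6) ∷ (# 5 , # 4) ∷ (# 6 , # 4) ∷ []))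
  (# 0) (# 0 ∷ # 0 ∷ # 0 ∷ # 1 ∷ # 2 ∷ # 3 ∷ # 3 ∷ [])

subdividedK4WithApex : Rooted 3 12
subdividedK4WithApex = rootedByEvaluation
  (edgeGraph ((# 0 , # 1) ∷ (# 1 , # 3) ∷ (# 0 , # 2) ∷ (# 2 , # 4) ∷ (# 3 , # 7) ∷
              (# 7 , # 5) ∷ (# 3 , # 8) ∷ (# 8 , # 6) ∷ (# 4 , # 9) ∷ (# 9 , # 5) ∷
              (# 4 , # 10) ∷ (# 10 , # 6) ∷ (# 5 , # 11) ∷ (# 11 , # 6) ∷ []))
  (# 0) (# 0 ∷ # 0 ∷ # 0 ∷ # 1 ∷ # 2 ∷ # 7 ∷ # 8 ∷ # 3 ∷ # 3 ∷ # 4 ∷ # 4 ∷ # 5 ∷ [])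

completeBipartite23 : ConnectedSI 5
completeBipartite23 = closedByEvaluation
  (edgeGraph ((# 0 , # 2) ∷ (# 0 , # 3) ∷ (# 0 , # 4) ∷ (# 1 , # 2) ∷ (# 1 , # 3) ∷
              (# 1 , # 4) ∷ []))
  (# 0) (# 0 ∷ # 2 ∷ # 0 ∷ # 0 ∷ # 0 ∷ [])

subdividedK4 : ConnectedSI 10
subdividedK4 = closedByEvaluation
  (edgeGraph ((# 0 , # 4) ∷ (# 4 , # 1) ∷ (# 0 , # 5) ∷ (# 5 , # 2) ∷ (# 0 , # 6) ∷
              (# 6 , # 3) ∷ (# 1 , # 7) ∷ (# 7 , # 2) ∷ (# 1 , # 8) ∷ (# 8 , # 3) ∷
              (# 2 , # 9) ∷ (# 9 , # 3) ∷ []))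
  (# 0) (# 0 ∷ # 4 ∷ # 5 ∷ # 6 ∷ # 0 ∷ # 0 ∷ # 0 ∷ # 1 ∷ # 1 ∷ # 2 ∷ [])

data Realisable : ℕ → Set where
  viaSingleVertex   : ∀ j → Realisable (1 + chainOrder j)
  viaSquareWithTail : ∀ j → Realisable (6 + chainOrder j)
  viaTheta          : ∀ j → Realisable (7 + chainOrder j)
  viaApexK4         : ∀ j → Realisable (12 + chainOrder j)
  viaSubdividedK4   : Realisable 10

realise : ∀ {n} → Realisable n → ConnectedSI n
realise (viaSingleVertex j)   = close singleVertex         (chain j) (inj₂ refl)
realise (viaSquareWithTail j) = close squareWithTail       (chain j) (inj₁ refl)
realise (viaTheta j)          = close theta                (chain j) (inj₁ refl)
realise (viaApexK4 j)         = close subdividedK4WithApex (chain j) (inj₁ refl)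
realise viaSubdividedK4       = subdividedK4

-- Four more vertices: one more growing step of the chain (from order 10 on,
-- the apex piece takes over from the subdivided K4).
plusFour : ∀ {n} → Realisable n → Realisable (4 + n)
plusFour (viaSingleVertex j)   = viaSingleVertex (suc j)
plusFour (viaSquareWithTail j) = viaSquareWithTail (suc j)
plusFour (viaTheta j)          = viaTheta (suc j)
plusFour (viaApexK4 j)         = viaApexK4 (suc j)
plusFour viaSubdividedK4       = viaApexK4 zero

fromSeven : ∀ m → Realisable (7 + m)
fromSeven 0                         = viaSingleVertex 1
fromSeven 1                         = viaSquareWithTail 0
fromSeven 2                         = viaTheta 0
fromSeven 3                         = viaSubdividedK4
fromSeven (suc (suc (suc (suc m)))) = plusFour (fromSeven m)

mainTheorem4 : (n : ℕ) → ¬ (n ≡ 0) → ¬ (n ≡ 1) → ¬ (n ≡ 2) → ¬ (n ≡ 4) →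
    ¬ (n ≡ 6) → Σ (Graph n) (λ G → Connected G × StepwiseIrregular G)
mainTheorem4 0 n≢0 _ _ _ _ = ⊥-elim (n≢0 refl)
mainTheorem4 1 _ n≢1 _ _ _ = ⊥-elim (n≢1 refl)
mainTheorem4 2 _ _ n≢2 _ _ = ⊥-elim (n≢2 refl)
mainTheorem4 3 _ _ _ _ _   = realise (viaSingleVertex 0)
mainTheorem4 4 _ _ _ n≢4 _ = ⊥-elim (n≢4 refl)
mainTheorem4 5 _ _ _ _ _   = completeBipartite23
mainTheorem4 6 _ _ _ _ n≢6 = ⊥-elim (n≢6 refl)
mainTheorem4 (suc (suc (suc (suc (suc (suc (suc m))))))) _ _ _ _ _ = realise (fromSeven m)
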